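{- Let $c_n$ denote the number of connected chord diagrams with $n$ chords. For every fixed integer $j\ge 2$, as $n\to\infty$, \[(n-1)\sum_{k=j}^{n-j}\frac{c_k\,c_{n-k}}{c_n} = O\!\left(\frac{1}{n^{j-1}}\right).\]
   Context: A chord diagram with $n$ chords is a perfect matching of $\{1,2,\dots,2n\}$; each pair $\{a,b\}$ with $a<b$ is a chord. The oriented intersection graph of a chord diagram has a vertex for each chord and an edge from chord $\{a,b\}$ to chord $\{c,d\}$ whenever $a<c<b<d$. A chord diagram is connected if its oriented intersection graph is connected (as an undirected graph). -}

module Defs where

open import Data.Nat using (ℕ; zero; suc; _+_; _*_; _∸_; _<ᵇ_; _≡ᵇ_)
open import Data.Bool using (Bool; true; false; _∧_; _∨_)
open import Data.Product using (_×_; _,_)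
open import Data.List using (List; []; _∷_; map; concatMap; length; filter; upTo)
open import Data.Bool.ListAction using (any; all)
open import Data.Nat.ListAction using (sum)
open import Relation.Nullary.Decidable using (Dec; yes; no)
open import Data.Bool using (T?)

-- A chord is a pair (a , b) with a < b; a chord diagram with n chords is
-- a perfect matching of {0,…,2n-1} (we use 0-based labels instead of 1..2n,
-- which does not change the order structure), given as a list of chords.
Chord : Set
Chord = ℕ × ℕ

Diagram : Set
Diagram = List Chord

picks : List ℕ → List (ℕ × List ℕ)
picks [] = []
picks (x ∷ xs) = (x , xs) ∷ map (λ { (y , r) → (y , x ∷ r) }) (picks xs)

-- perfect matchings of a list of (distinct, increasing) labels, with fuel k = number of chords:
-- the smallest remaining label x is paired with some other remaining label y (so x < y).
matchingsOf : ℕ → List ℕ → List Diagram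
matchingsOf zero [] = [] ∷ []
matchingsOf zero (_ ∷ _) = []
matchingsOf (suc k) [] = []
matchingsOf (suc k) (x ∷ xs) =
  concatMap (λ { (y , rest) → map ((x , y) ∷_) (matchingsOf k rest) }) (picks xs)

diagrams : ℕ → List Diagram
diagrams n = matchingsOf n (upTo (n + n))

edge : Chord → Chord → Bool
edge (a , b) (c , d) = (a <ᵇ c) ∧ (c <ᵇ b) ∧ (b <ᵇ d)

adj : Chord → Chord → Bool
adj x y = edge x y ∨ edge y x

chordEq : Chord → Chord → Bool
chordEq (a , b) (c , d) = (a ≡ᵇ c) ∧ (b ≡ᵇ d)

reachable : Diagram → ℕ → Chord → Chord → Bool
reachable D zero x y = chordEq x y
reachable D (suc m) x y = reachable D m x y ∨ any (λ z → adj z y ∧ reachable D m x z) D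

-- connected: every two chords are joined by a path (paths in a graph with
-- |D| vertices can be taken of length ≤ |D|)
connected : Diagram → Bool
connected D = all (λ x → all (λ y → reachable D (length D) x y) D) D

c : ℕ → ℕ
c n = length (filter (λ D → T? (connected D)) (diagrams n))

-- Σ_{k=j}^{n-j} c_k c_{n-k}  (empty sum if n - j < j)
convSum : ℕ → ℕ → ℕ
convSum j n = sum (map (λ k → c k * c (n ∸ k)) (map (j +_) (upTo (suc (n ∸ j) ∸ j))))

-- Two estimates on c drive the bound. Above, c s ≤ (2s − 1)!!, the number of all diagrams.
-- Below, putting a new chord (0, t + 1) into a connected diagram with m chords keeps it
-- connected for each of the 2m − 1 inner gaps t, because some chord straddles every gap; so
-- (2m − 1) c m ≤ c (m + 1), and iterating gives (n − 1)^s c (n − s) ≤ c n when 2s ≤ n.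
-- With q = n − 1 and b ≤ s ≤ n − s this yields q^b c s c (n − s) ≤ (2b − 1)!! c n, since
-- (2s − 1)!! ≤ q^(s − b) (2b − 1)!!. Taking b = j for the two end terms of the convolution and
-- b = j + 1 for the at most q inner ones gives q^j Σ ≤ (2 (2j − 1)!! + (2j + 1)!!) c n, and
-- n ≤ 2q converts q^j into (n − 1) n^(j − 1) at the cost of a factor 2^(j − 1).

module Submission where

open import Defs
open import Data.Bool using (Bool; true; false; _∧_; _∨_; T; T?; if_then_else_)
open import Data.Bool.ListAction using (or)
open import Data.Bool.Properties using (T-∧; T-∨)
open import Data.Empty using (⊥-elim)
open import Data.List using (List; []; _∷_; _++_; map; concatMap; length; filter; upTo; applyUpTo)
open import Data.List.Membership.Propositional using (_∈_; find; lose)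
open import Data.List.Membership.Propositional.Properties using (∈-map⁻; ∈-map⁺; ∈-concatMap⁻; ∈-applyUpTo⁺)
open import Data.List.Properties
  using (length-filter; length-upTo; length-map; length-++; map-∘; map-cong; map-upTo; map-applyUpTo;
         applyUpTo-∷ʳ; concatMap-map; map-concatMap; concatMap-cong)
open import Data.List.Relation.Binary.Subset.Propositional using (_⊆_)
open import Data.List.Relation.Unary.All as All using (All; []; _∷_)
open import Data.List.Relation.Unary.All.Properties using (all⁺; all⁻)
open import Data.List.Relation.Unary.Any as Any using (here; there; any?)
open import Data.List.Relation.Unary.Any.Properties using (any⁺; any⁻)
open import Data.Nat
  using (ℕ; zero; suc; _+_; _*_; _∸_; _^_; _≤_; _<_; _<ᵇ_; _≡ᵇ_; z≤n; s≤s; _<?_; _≤?_; >-nonZero)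
open import Data.Nat.ListAction using (sum)
open import Data.Nat.ListAction.Properties using (sum-++)
open import Data.Nat.Properties
open import Data.Nat.Tactic.RingSolver using (solve-∀)
open import Data.Product using (_×_; _,_; proj₁; proj₂; ∃-syntax)
open import Data.Sum as Sum using (_⊎_; inj₁; inj₂)
open import Function using (_∘_; id)
open import Function.Bundles using (module Equivalence)
open import Relation.Binary.PropositionalEquality
open import Relation.Nullary using (yes; no)
open import Relation.Nullary.Decidable using (_×-dec_)

open Equivalence using (to; from)

private
  variable
    A B : Set

count : (A → Bool) → List A → ℕ
count p [] = 0
count p (x ∷ xs) = (if p x then 1 else 0) + count p xs

length-filter≡count : (p : A → Bool) (xs : List A) → length (filter (T? ∘ p) xs) ≡ count p xs
length-filter≡count p [] = refl
length-filter≡count p (x ∷ xs) with p x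
... | true = cong suc (length-filter≡count p xs)
... | false = length-filter≡count p xs

count-map : (p : B → Bool) (f : A → B) (xs : List A) → count p (map f xs) ≡ count (p ∘ f) xs
count-map p f [] = refl
count-map p f (x ∷ xs) = cong ((if p (f x) then 1 else 0) +_) (count-map p f xs)

count-++ : (p : A → Bool) (xs ys : List A) → count p (xs ++ ys) ≡ count p xs + count p ys
count-++ p [] ys = refl
count-++ p (x ∷ xs) ys =
  trans (cong ((if p x then 1 else 0) +_) (count-++ p xs ys)) (sym (+-assoc (if p x then 1 else 0) _ _))

count-concatMap : (p : B → Bool) (f : A → List B) (xs : List A) →
  count p (concatMap f xs) ≡ sum (map (count p ∘ f) xs)
count-concatMap p f [] = refl
count-concatMap p f (x ∷ xs) = trans (count-++ p (f x) (concatMap f xs)) (cong (count p (f x) +_) (count-concatMap p f xs))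

count-mono : (p q : A → Bool) (xs : List A) → All (λ x → T (p x) → T (q x)) xs → count p xs ≤ count q xs
count-mono p q [] [] = z≤n
count-mono p q (x ∷ xs) (p⇒q ∷ ps) with p x | q x | p⇒q
... | true | true | _ = s≤s (count-mono p q xs ps)
... | true | false | contra = ⊥-elim (contra _)
... | false | true | _ = m≤n⇒m≤1+n (count-mono p q xs ps)
... | false | false | _ = count-mono p q xs ps

length-concatMap : (f : A → List B) (xs : List A) → length (concatMap f xs) ≡ sum (map (length ∘ f) xs)
length-concatMap f [] = refl
length-concatMap f (x ∷ xs) = trans (length-++ (f x)) (cong (length (f x) +_) (length-concatMap f xs))

*-sum-applyUpTo-≥ : ∀ {k n a} (f : ℕ → ℕ) → (∀ i → i < k → a ≤ f i) → k ≤ n →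
  k * a ≤ sum (applyUpTo f n)
*-sum-applyUpTo-≥ {zero} f a≤f k≤n = z≤n
*-sum-applyUpTo-≥ {suc k} {suc n} f a≤f (s≤s k≤n) =
  +-mono-≤ (a≤f 0 (s≤s z≤n)) (*-sum-applyUpTo-≥ (f ∘ suc) (λ i i<k → a≤f (suc i) (s≤s i<k)) k≤n)

*-sum-applyUpTo-≤ : ∀ {e a b} (f : ℕ → ℕ) → (∀ i → i < e → a * f i ≤ b) →
  a * sum (applyUpTo f e) ≤ e * b
*-sum-applyUpTo-≤ {zero} {a} f _ = ≤-reflexive (*-zeroʳ a)
*-sum-applyUpTo-≤ {suc e} {a} {b} f af≤b = begin
  a * (f 0 + sum (applyUpTo (f ∘ suc) e))          ≡⟨ *-distribˡ-+ a (f 0) _ ⟩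
  a * f 0 + a * sum (applyUpTo (f ∘ suc) e)
    ≤⟨ +-mono-≤ (af≤b 0 (s≤s z≤n)) (*-sum-applyUpTo-≤ {a = a} (f ∘ suc) (λ i i<e → af≤b (suc i) (s≤s i<e))) ⟩
  b + e * b                                        ∎
  where open ≤-Reasoning

sum-applyUpTo-ends : ∀ (f : ℕ → ℕ) e →
  sum (applyUpTo f (suc (suc e))) ≡ f 0 + (sum (applyUpTo (f ∘ suc) e) + f (suc e))
sum-applyUpTo-ends f e = cong (f 0 +_) (begin
  sum (applyUpTo (f ∘ suc) (suc e))               ≡⟨ cong sum (applyUpTo-∷ʳ (f ∘ suc) e) ⟨
  sum (applyUpTo (f ∘ suc) e ++ f (suc e) ∷ [])   ≡⟨ sum-++ (applyUpTo (f ∘ suc) e) (f (suc e) ∷ []) ⟩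
  sum (applyUpTo (f ∘ suc) e) + (f (suc e) + 0)   ≡⟨ cong (sum (applyUpTo (f ∘ suc) e) +_) (+-identityʳ (f (suc e))) ⟩
  sum (applyUpTo (f ∘ suc) e) + f (suc e)         ∎)
  where open ≡-Reasoning

m≤n*o⇒m^k≤n^k*o^k : ∀ {m n o} k → m ≤ n * o → m ^ k ≤ n ^ k * o ^ k
m≤n*o⇒m^k≤n^k*o^k zero _ = ≤-refl
m≤n*o⇒m^k≤n^k*o^k {m} {n} {o} (suc k) m≤no = begin
  m * m ^ k                        ≤⟨ *-mono-≤ m≤no (m≤n*o⇒m^k≤n^k*o^k k m≤no) ⟩
  n * o * (n ^ k * o ^ k)          ≡⟨ interchange n o (n ^ k) (o ^ k) ⟩
  n * n ^ k * (o * o ^ k)          ∎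
  where
  open ≤-Reasoning
  interchange : ∀ w x y z → w * x * (y * z) ≡ w * y * (x * z)
  interchange = solve-∀

-- Chord diagrams as matchings

oddDoubleFactorial : ℕ → ℕ
oddDoubleFactorial zero = 1
oddDoubleFactorial (suc k) = suc (k + k) * oddDoubleFactorial k

sum-map-picks : (F : ℕ × List ℕ → ℕ) (b : ℕ) (xs : List ℕ) →
  (∀ y rest → suc (length rest) ≡ length xs → F (y , rest) ≡ b) → sum (map F (picks xs)) ≡ length xs * b
sum-map-picks F b [] F≡b = refl
sum-map-picks F b (x ∷ xs) F≡b = cong₂ _+_ (F≡b x xs refl)
  (trans (cong sum (sym (map-∘ (picks xs))))
         (sum-map-picks (λ (y , rest) → F (y , x ∷ rest)) b xs (λ y rest eq → F≡b y (x ∷ rest) (cong suc eq))))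

length-matchingsOf : ∀ k (labels : List ℕ) → length labels ≡ k + k →
  length (matchingsOf k labels) ≡ oddDoubleFactorial k
length-matchingsOf zero [] _ = refl
length-matchingsOf (suc k) (x ∷ xs) eq = begin
  length (concatMap extend (picks xs))                   ≡⟨ length-concatMap extend (picks xs) ⟩
  sum (map (length ∘ extend) (picks xs))                 ≡⟨ sum-map-picks (length ∘ extend) _ xs length-extend ⟩
  length xs * oddDoubleFactorial k                       ≡⟨ cong (_* oddDoubleFactorial k) length-xs ⟩
  suc (k + k) * oddDoubleFactorial k                     ∎
  where
  open ≡-Reasoning
  extend : ℕ × List ℕ → List Diagram
  extend (y , rest) = map ((x , y) ∷_) (matchingsOf k rest)
  length-xs : length xs ≡ suc (k + k)
  length-xs = trans (suc-injective eq) (+-suc k k)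
  length-extend : ∀ y rest → suc (length rest) ≡ length xs → length (extend (y , rest)) ≡ oddDoubleFactorial k
  length-extend y rest eq′ = trans (length-map _ (matchingsOf k rest))
    (length-matchingsOf k rest (suc-injective (trans eq′ length-xs)))

c≤oddDoubleFactorial : ∀ k → c k ≤ oddDoubleFactorial k
c≤oddDoubleFactorial k = ≤-trans (length-filter _ (diagrams k))
  (≤-reflexive (length-matchingsOf k (upTo (k + k)) (length-upTo (k + k))))

mapChord : (ℕ → ℕ) → Chord → Chord
mapChord g (a , b) = g a , g b

-- As Data.Fin.punchIn: the order embedding of ℕ that skips the value t.
punchIn : ℕ → ℕ → ℕ
punchIn zero a = suc a
punchIn (suc t) zero = zero
punchIn (suc t) (suc a) = suc (punchIn t a)

punchIn-< : ∀ t a → a < t → punchIn t a ≡ a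
punchIn-< (suc t) zero _ = refl
punchIn-< (suc t) (suc a) (s≤s a<t) = cong suc (punchIn-< t a a<t)

punchIn-≥ : ∀ t a → t ≤ a → punchIn t a ≡ suc a
punchIn-≥ zero a _ = refl
punchIn-≥ (suc t) (suc a) (s≤s t≤a) = cong suc (punchIn-≥ t a t≤a)

punchIn-<ᵇ : ∀ t a b → (punchIn t a <ᵇ punchIn t b) ≡ (a <ᵇ b)
punchIn-<ᵇ zero a b = refl
punchIn-<ᵇ (suc t) zero zero = refl
punchIn-<ᵇ (suc t) zero (suc b) = refl
punchIn-<ᵇ (suc t) (suc a) zero = refl
punchIn-<ᵇ (suc t) (suc a) (suc b) = punchIn-<ᵇ t a b

punchIn-≡ᵇ : ∀ t a b → (punchIn t a ≡ᵇ punchIn t b) ≡ (a ≡ᵇ b)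
punchIn-≡ᵇ zero a b = refl
punchIn-≡ᵇ (suc t) zero zero = refl
punchIn-≡ᵇ (suc t) zero (suc b) = refl
punchIn-≡ᵇ (suc t) (suc a) zero = refl
punchIn-≡ᵇ (suc t) (suc a) (suc b) = punchIn-≡ᵇ t a b

picks-applyUpTo : (f : ℕ → ℕ) (n : ℕ) →
  picks (applyUpTo f (suc n)) ≡ applyUpTo (λ i → f i , applyUpTo (f ∘ punchIn i) n) (suc n)
picks-applyUpTo f zero = refl
picks-applyUpTo f (suc n) = cong ((f 0 , applyUpTo (f ∘ suc) (suc n)) ∷_)
  (trans (cong (map (λ (y , rest) → y , f 0 ∷ rest)) (picks-applyUpTo (f ∘ suc) n))
         (map-applyUpTo (λ i → f (suc i) , applyUpTo (f ∘ suc ∘ punchIn i) n)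
                        (λ (y , rest) → y , f 0 ∷ rest) (suc n)))

picks-map : (g : ℕ → ℕ) (xs : List ℕ) → picks (map g xs) ≡ map (λ (y , rest) → g y , map g rest) (picks xs)
picks-map g [] = refl
picks-map g (x ∷ xs) = cong ((g x , map g xs) ∷_)
  (trans (cong (map (λ (y , rest) → y , g x ∷ rest)) (picks-map g xs))
         (trans (sym (map-∘ (picks xs))) (map-∘ (picks xs))))

matchingsOf-map : (g : ℕ → ℕ) (k : ℕ) (labels : List ℕ) →
  matchingsOf k (map g labels) ≡ map (map (mapChord g)) (matchingsOf k labels)
matchingsOf-map g zero [] = refl
matchingsOf-map g zero (_ ∷ _) = refl
matchingsOf-map g (suc k) [] = refl
matchingsOf-map g (suc k) (x ∷ xs) = begin
  concatMap (λ (y , rest) → map ((g x , y) ∷_) (matchingsOf k rest)) (picks (map g xs))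
    ≡⟨ cong (concatMap _) (picks-map g xs) ⟩
  concatMap (λ (y , rest) → map ((g x , y) ∷_) (matchingsOf k rest)) (map (λ (y , rest) → g y , map g rest) (picks xs))
    ≡⟨ concatMap-map _ _ (picks xs) ⟩
  concatMap (λ (y , rest) → map ((g x , g y) ∷_) (matchingsOf k (map g rest))) (picks xs)
    ≡⟨ concatMap-cong relabel-extension (picks xs) ⟩
  concatMap (λ (y , rest) → map (map (mapChord g)) (map ((x , y) ∷_) (matchingsOf k rest))) (picks xs)
    ≡⟨ map-concatMap (map (mapChord g)) _ (picks xs) ⟨
  map (map (mapChord g)) (concatMap (λ (y , rest) → map ((x , y) ∷_) (matchingsOf k rest)) (picks xs)) ∎
  where
  open ≡-Reasoning
  relabel-extension : ∀ ((y , rest) : ℕ × List ℕ) →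
    map ((g x , g y) ∷_) (matchingsOf k (map g rest)) ≡ map (map (mapChord g)) (map ((x , y) ∷_) (matchingsOf k rest))
  relabel-extension (y , rest) = trans (cong (map _) (matchingsOf-map g k rest))
    (trans (sym (map-∘ (matchingsOf k rest))) (map-∘ (matchingsOf k rest)))

∈-picks : ∀ {z} xs p → p ∈ picks xs → z ∈ xs → z ≡ proj₁ p ⊎ z ∈ proj₂ p
∈-picks (x ∷ xs) p (here refl) (here refl) = inj₁ refl
∈-picks (x ∷ xs) p (here refl) (there z∈xs) = inj₂ z∈xs
∈-picks (x ∷ xs) p (there p∈) z∈ with ∈-map⁻ (λ (y , rest) → y , x ∷ rest) p∈
∈-picks (x ∷ xs) p (there p∈) (here refl) | _ , _ , refl = inj₂ (here refl)
∈-picks (x ∷ xs) p (there p∈) (there z∈xs) | p′ , p′∈ , refl = Sum.map₂ there (∈-picks xs p′ p′∈ z∈xs)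

∈-matchingsOf-suc : ∀ {D} k x xs → D ∈ matchingsOf (suc k) (x ∷ xs) →
  ∃[ p ] (p ∈ picks xs × ∃[ D′ ] (D′ ∈ matchingsOf k (proj₂ p) × D ≡ (x , proj₁ p) ∷ D′))
∈-matchingsOf-suc k x xs D∈
  with find (∈-concatMap⁻ (λ (y , rest) → map ((x , y) ∷_) (matchingsOf k rest)) {xs = picks xs} D∈)
... | p , p∈ , D∈′ with ∈-map⁻ ((x , proj₁ p) ∷_) D∈′
... | D′ , D′∈ , eq = p , p∈ , D′ , D′∈ , eq

matchingsOf-covers : ∀ {z} k labels D → D ∈ matchingsOf k labels → z ∈ labels →
  ∃[ W ] (W ∈ D × (z ≡ proj₁ W ⊎ z ≡ proj₂ W))
matchingsOf-covers (suc k) (x ∷ xs) D D∈ z∈ with ∈-matchingsOf-suc k x xs D∈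
... | (y , rest) , p∈ , D′ , D′∈ , refl with z∈
... | here refl = (x , y) , here refl , inj₁ refl
... | there z∈xs with ∈-picks xs (y , rest) p∈ z∈xs
... | inj₁ z≡y = (x , y) , here refl , inj₂ z≡y
... | inj₂ z∈rest with matchingsOf-covers k rest D′ D′∈ z∈rest
... | W , W∈ , z∈W = W , there W∈ , z∈W

chordEq⇒≡ : ∀ x y → T (chordEq x y) → x ≡ y
chordEq⇒≡ (a , b) (a′ , b′) eq =
  let a≡a′ , b≡b′ = to T-∧ eq in cong₂ _,_ (≡ᵇ⇒≡ a a′ a≡a′) (≡ᵇ⇒≡ b b′ b≡b′)

chordEq-refl : ∀ x → T (chordEq x x)
chordEq-refl (a , b) = from T-∧ (≡⇒≡ᵇ a a refl , ≡⇒≡ᵇ b b refl)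

adj-sym : ∀ x y → T (adj x y) → T (adj y x)
adj-sym x y xy = from (T-∨ {edge y x}) (Sum.swap (to (T-∨ {edge x y}) xy))

module _ (D : Diagram) where

  reachable-refl : ∀ m x → T (reachable D m x x)
  reachable-refl zero x = chordEq-refl x
  reachable-refl (suc m) x = from T-∨ (inj₁ (reachable-refl m x))

  reachable-suc : ∀ m x y → T (reachable D m x y) → T (reachable D (suc m) x y)
  reachable-suc m x y r = from T-∨ (inj₁ r)

  reachable-snoc : ∀ m x z y → z ∈ D → T (reachable D m x z) → T (adj z y) → T (reachable D (suc m) x y)
  reachable-snoc m x z y z∈D xz zy =
    from T-∨ (inj₂ (any⁺ (λ w → adj w y ∧ reachable D m x w) (Any.map (λ { refl → from T-∧ (zy , xz) }) z∈D)))

  reachable-suc⁻ : ∀ m x y → T (reachable D (suc m) x y) →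
    T (reachable D m x y) ⊎ ∃[ z ] (z ∈ D × T (adj z y) × T (reachable D m x z))
  reachable-suc⁻ m x y r with to T-∨ r
  ... | inj₁ xy = inj₁ xy
  ... | inj₂ via with find (any⁻ _ D via)
  ... | z , z∈D , zy∧xz = let zy , xz = to T-∧ zy∧xz in inj₂ (z , z∈D , zy , xz)

  reachable-cons : ∀ m x w y → x ∈ D → T (adj x w) → T (reachable D m w y) → T (reachable D (suc m) x y)
  reachable-cons zero x w y x∈D xw wy with chordEq⇒≡ w y wy
  ... | refl = reachable-snoc zero x x y x∈D (reachable-refl zero x) xw
  reachable-cons (suc m) x w y x∈D xw wy with reachable-suc⁻ m w y wy
  ... | inj₁ wy′ = reachable-suc (suc m) x y (reachable-cons m x w y x∈D xw wy′)
  ... | inj₂ (z , z∈D , zy , wz) = reachable-snoc (suc m) x z y z∈D (reachable-cons m x w z x∈D xw wz) zy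

reachable-⊆ : ∀ {D E} → D ⊆ E → ∀ m x y → T (reachable D m x y) → T (reachable E m x y)
reachable-⊆ D⊆E zero x y r = r
reachable-⊆ {D} {E} D⊆E (suc m) x y r with reachable-suc⁻ D m x y r
... | inj₁ xy = reachable-suc E m x y (reachable-⊆ D⊆E m x y xy)
... | inj₂ (z , z∈D , zy , xz) = reachable-snoc E m x z y (D⊆E z∈D) (reachable-⊆ D⊆E m x z xz) zy

connected⁻ : ∀ {D x y} → T (connected D) → x ∈ D → y ∈ D → T (reachable D (length D) x y)
connected⁻ {D} conn x∈D y∈D = All.lookup (all⁺ _ D (All.lookup (all⁺ _ D conn) x∈D)) y∈D

connected⁺ : ∀ {D} → (∀ {x y} → x ∈ D → y ∈ D → T (reachable D (length D) x y)) → T (connected D)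
connected⁺ {D} reach = all⁻ _ (All.tabulate (λ x∈D → all⁻ _ (All.tabulate (reach x∈D))))

connected-∷ : ∀ {D} N W → W ∈ D → T (adj N W) → T (connected D) → T (connected (N ∷ D))
connected-∷ {D} N W W∈D NW conn = connected⁺ reach
  where
  E = N ∷ D
  m = length D
  reachD : ∀ {x y} → x ∈ D → y ∈ D → T (reachable E m x y)
  reachD x∈D y∈D = reachable-⊆ there m _ _ (connected⁻ conn x∈D y∈D)
  reach : ∀ {x y} → x ∈ E → y ∈ E → T (reachable E (suc m) x y)
  reach (here refl) (here refl) = reachable-refl E (suc m) N
  reach (here refl) (there y∈D) = reachable-cons E m N W _ (here refl) NW (reachD W∈D y∈D)
  reach (there x∈D) (here refl) = reachable-snoc E m _ W N (there W∈D) (reachD x∈D W∈D) (adj-sym N W NW)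
  reach (there x∈D) (there y∈D) = reachable-suc E m _ _ (reachD x∈D y∈D)

module Relabel (g : ℕ → ℕ)
  (g-<ᵇ : ∀ a b → (g a <ᵇ g b) ≡ (a <ᵇ b))
  (g-≡ᵇ : ∀ a b → (g a ≡ᵇ g b) ≡ (a ≡ᵇ b)) where

  edge-relabel : ∀ x y → edge (mapChord g x) (mapChord g y) ≡ edge x y
  edge-relabel (a , b) (a′ , b′) = cong₂ _∧_ (g-<ᵇ a a′) (cong₂ _∧_ (g-<ᵇ a′ b) (g-<ᵇ b b′))

  adj-relabel : ∀ x y → adj (mapChord g x) (mapChord g y) ≡ adj x y
  adj-relabel x y = cong₂ _∨_ (edge-relabel x y) (edge-relabel y x)

  reachable-relabel : ∀ D m x y → reachable (map (mapChord g) D) m (mapChord g x) (mapChord g y) ≡ reachable D m x y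
  reachable-relabel D zero (a , b) (a′ , b′) = cong₂ _∧_ (g-≡ᵇ a a′) (g-≡ᵇ b b′)
  reachable-relabel D (suc m) x y = cong₂ _∨_ (reachable-relabel D m x y) (cong or (begin
    map (λ z → adj z (mapChord g y) ∧ reachable (map (mapChord g) D) m (mapChord g x) z) (map (mapChord g) D)
      ≡⟨ map-∘ D ⟨
    map (λ z → adj (mapChord g z) (mapChord g y) ∧ reachable (map (mapChord g) D) m (mapChord g x) (mapChord g z)) D
      ≡⟨ map-cong (λ z → cong₂ _∧_ (adj-relabel z y) (reachable-relabel D m x z)) D ⟩
    map (λ z → adj z y ∧ reachable D m x z) D ∎))
    where open ≡-Reasoning

  connected-relabel : ∀ D → T (connected D) → T (connected (map (mapChord g) D))
  connected-relabel D conn = connected⁺ reach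
    where
    reach : ∀ {x y} → x ∈ map (mapChord g) D → y ∈ map (mapChord g) D →
      T (reachable (map (mapChord g) D) (length (map (mapChord g) D)) x y)
    reach x∈ y∈ with ∈-map⁻ (mapChord g) x∈ | ∈-map⁻ (mapChord g) y∈
    ... | x , x∈D , refl | y , y∈D , refl rewrite length-map (mapChord g) D | reachable-relabel D (length D) x y =
      connected⁻ conn x∈D y∈D

Straddles : ℕ → Chord → Set
Straddles t (a , b) = a < t × t ≤ b

reachable-stays-left : ∀ D t → (∀ {z} → z ∈ D → proj₁ z < t → proj₂ z < t) →
  ∀ m x y → T (reachable D m x y) → proj₁ x < t → proj₁ y < t
reachable-stays-left D t unstraddled zero x y xy x<t with chordEq⇒≡ x y xy
... | refl = x<t
reachable-stays-left D t unstraddled (suc m) x y xy x<t with reachable-suc⁻ D m x y xy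
... | inj₁ xy′ = reachable-stays-left D t unstraddled m x y xy′ x<t
... | inj₂ (z , z∈D , zy , xz) with reachable-stays-left D t unstraddled m x z xz x<t | to (T-∨ {edge z y}) zy
... | z<t | inj₁ z→y =
  <-trans (<ᵇ⇒< _ _ (proj₁ (to T-∧ (proj₂ (to (T-∧ {proj₁ z <ᵇ proj₁ y}) z→y))))) (unstraddled z∈D z<t)
... | z<t | inj₂ y→z = <-trans (<ᵇ⇒< _ _ (proj₁ (to T-∧ y→z))) z<t

connected⇒straddled : ∀ m t D → D ∈ diagrams (suc m) → T (connected D) → 0 < t → t < suc m + suc m →
  ∃[ W ] (W ∈ D × Straddles t W)
connected⇒straddled m t D D∈ conn 0<t t<2m with any? (λ W → (proj₁ W <? t) ×-dec (t ≤? proj₂ W)) D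
... | yes straddled = find straddled
... | no unstraddled with ∈-matchingsOf-suc m 0 (applyUpTo suc (m + suc m)) D∈
... | (y , _) , _ , D′ , _ , refl with matchingsOf-covers (suc m) (upTo (suc m + suc m)) _ D∈ (∈-applyUpTo⁺ id t<2m)
... | R , R∈D , t∈R = ⊥-elim (unstraddled (lose R∈D (R<t , t≤R t∈R)))
  where
  stays-left : ∀ {z} → z ∈ D → proj₁ z < t → proj₂ z < t
  stays-left {z} z∈D z<t with t ≤? proj₂ z
  ... | yes t≤z = ⊥-elim (unstraddled (lose z∈D (z<t , t≤z)))
  ... | no t≰z = ≰⇒> t≰z
  R<t : proj₁ R < t
  R<t = reachable-stays-left D t stays-left (length D) (0 , y) R (connected⁻ conn (here refl) R∈D) 0<t
  t≤R : t ≡ proj₁ R ⊎ t ≡ proj₂ R → t ≤ proj₂ R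
  t≤R (inj₁ t≡R) = ⊥-elim (<-irrefl (sym t≡R) R<t)
  t≤R (inj₂ t≡R) = ≤-reflexive t≡R

-- Growth of c

-- The diagrams with m + 1 chords whose chord at 0 is (0, t + 1): suc ∘ punchIn t lists the
-- remaining labels in increasing order.
withFirstChord : ℕ → ℕ → List Diagram
withFirstChord m t = map ((0 , suc t) ∷_) (matchingsOf m (applyUpTo (suc ∘ punchIn t) (m + m)))

c-suc≡sum-withFirstChord : ∀ m → c (suc m) ≡ sum (applyUpTo (count connected ∘ withFirstChord m) (suc (m + m)))
c-suc≡sum-withFirstChord m = begin
  c (suc m)
    ≡⟨ length-filter≡count connected (diagrams (suc m)) ⟩
  count connected (concatMap extend (picks (applyUpTo suc (m + suc m))))
    ≡⟨ count-concatMap connected extend (picks (applyUpTo suc (m + suc m))) ⟩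
  sum (map (count connected ∘ extend) (picks (applyUpTo suc (m + suc m))))
    ≡⟨ cong (λ l → sum (map (count connected ∘ extend) (picks (applyUpTo suc l)))) (+-suc m m) ⟩
  sum (map (count connected ∘ extend) (picks (applyUpTo suc (suc (m + m)))))
    ≡⟨ cong (sum ∘ map (count connected ∘ extend)) (picks-applyUpTo suc (m + m)) ⟩
  sum (map (count connected ∘ extend) (applyUpTo (λ i → suc i , applyUpTo (suc ∘ punchIn i) (m + m)) (suc (m + m))))
    ≡⟨ cong sum (map-applyUpTo (λ i → suc i , applyUpTo (suc ∘ punchIn i) (m + m))
                               (count connected ∘ extend) (suc (m + m))) ⟩
  sum (applyUpTo (count connected ∘ withFirstChord m) (suc (m + m))) ∎
  where
  open ≡-Reasoning
  extend : ℕ × List ℕ → List Diagram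
  extend (y , rest) = map ((0 , y) ∷_) (matchingsOf m rest)

-- Inserting the chord (0, t + 1) preserves connectivity since some chord straddles the gap at t.
c≤count-withFirstChord : ∀ m t → 0 < t → t < suc m + suc m → c (suc m) ≤ count connected (withFirstChord (suc m) t)
c≤count-withFirstChord m t 0<t t<2m = begin
  c (suc m)                                   ≡⟨ length-filter≡count connected (diagrams (suc m)) ⟩
  count connected (diagrams (suc m))          ≤⟨ count-mono _ _ (diagrams (suc m)) (All.tabulate insert-connected) ⟩
  count (connected ∘ ((0 , suc t) ∷_) ∘ map (mapChord g)) (diagrams (suc m))
    ≡⟨ count-map _ (map (mapChord g)) (diagrams (suc m)) ⟨
  count (connected ∘ ((0 , suc t) ∷_)) (map (map (mapChord g)) (diagrams (suc m)))
    ≡⟨ count-map connected ((0 , suc t) ∷_) (map (map (mapChord g)) (diagrams (suc m))) ⟨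
  count connected (map ((0 , suc t) ∷_) (map (map (mapChord g)) (diagrams (suc m))))
    ≡⟨ cong (count connected ∘ map ((0 , suc t) ∷_)) relabelled-diagrams ⟩
  count connected (withFirstChord (suc m) t) ∎
  where
  open ≤-Reasoning
  g = suc ∘ punchIn t
  open Relabel g (punchIn-<ᵇ t) (punchIn-≡ᵇ t)
  relabelled-diagrams : map (map (mapChord g)) (diagrams (suc m)) ≡ matchingsOf (suc m) (applyUpTo g (suc m + suc m))
  relabelled-diagrams = trans (sym (matchingsOf-map g (suc m) (upTo (suc m + suc m))))
                              (cong (matchingsOf (suc m)) (map-upTo g (suc m + suc m)))
  insert-connected : ∀ {D} → D ∈ diagrams (suc m) → T (connected D) →
    T (connected ((0 , suc t) ∷ map (mapChord g) D))
  insert-connected {D} D∈ conn with connected⇒straddled m t D D∈ conn 0<t t<2m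
  ... | (a , b) , W∈D , a<t , t≤b = connected-∷ _ (mapChord g (a , b)) (∈-map⁺ (mapChord g) W∈D) crossing
          (connected-relabel D conn)
    where
    crossing : T (adj (0 , suc t) (mapChord g (a , b)))
    crossing rewrite punchIn-< t a a<t | punchIn-≥ t b t≤b =
      from (T-∨ {edge (0 , suc t) (suc a , suc (suc b))})
           (inj₁ (from (T-∧ {a <ᵇ t}) (<⇒<ᵇ a<t , <⇒<ᵇ (s≤s t≤b))))

c-grows : ∀ m → suc (m + m) * c (suc m) ≤ c (suc (suc m))
c-grows m = begin
  suc (m + m) * c (suc m)                        ≤⟨ *-sum-applyUpTo-≥ (F ∘ suc) lower (s≤s (+-monoʳ-≤ m (n≤1+n m))) ⟩
  sum (applyUpTo (F ∘ suc) (suc m + suc m))      ≤⟨ m≤n+m _ (F 0) ⟩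
  sum (applyUpTo F (suc (suc m + suc m)))        ≡⟨ c-suc≡sum-withFirstChord (suc m) ⟨
  c (suc (suc m))                                ∎
  where
  open ≤-Reasoning
  F : ℕ → ℕ
  F = count connected ∘ withFirstChord (suc m)
  lower : ∀ i → i < suc (m + m) → c (suc m) ≤ count connected (withFirstChord (suc m) (suc i))
  lower i i<2m+1 = c≤count-withFirstChord m (suc i) (s≤s z≤n) (s≤s (≤-trans i<2m+1 (≤-reflexive (sym (+-suc m m)))))

c-grows-^ : ∀ r a {q} → q ≤ suc (a + a) → q ^ r * c (suc a) ≤ c (suc (r + a))
c-grows-^ zero a q≤ = ≤-reflexive (*-identityˡ (c (suc a)))
c-grows-^ (suc r) a {q} q≤ = begin
  q * q ^ r * c (suc a)                        ≡⟨ *-assoc q (q ^ r) (c (suc a)) ⟩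
  q * (q ^ r * c (suc a))                      ≤⟨ *-monoʳ-≤ q (c-grows-^ r a q≤) ⟩
  q * c (suc (r + a))                          ≤⟨ *-monoˡ-≤ (c (suc (r + a))) q≤2[r+a]+1 ⟩
  suc ((r + a) + (r + a)) * c (suc (r + a))    ≤⟨ c-grows (r + a) ⟩
  c (suc (suc (r + a)))                        ∎
  where
  open ≤-Reasoning
  q≤2[r+a]+1 : q ≤ suc ((r + a) + (r + a))
  q≤2[r+a]+1 = ≤-trans q≤ (s≤s (+-mono-≤ (m≤n+m a r) (m≤n+m a r)))

oddDoubleFactorial-≤-^ : ∀ r b {q} → (r + b) + (r + b) ≤ suc q →
  oddDoubleFactorial (r + b) ≤ q ^ r * oddDoubleFactorial b
oddDoubleFactorial-≤-^ zero b _ = ≤-reflexive (sym (*-identityˡ (oddDoubleFactorial b)))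
oddDoubleFactorial-≤-^ (suc r) b {q} (s≤s bound) = begin
  suc ((r + b) + (r + b)) * oddDoubleFactorial (r + b)
    ≤⟨ *-mono-≤ (≤-trans (≤-reflexive (sym (+-suc (r + b) (r + b)))) bound)
                (oddDoubleFactorial-≤-^ r b (≤-trans (+-monoʳ-≤ (r + b) (n≤1+n (r + b))) (m≤n⇒m≤1+n bound))) ⟩
  q * (q ^ r * oddDoubleFactorial b)      ≡⟨ *-assoc q (q ^ r) (oddDoubleFactorial b) ⟨
  q * q ^ r * oddDoubleFactorial b        ∎
  where open ≤-Reasoning

c-product-bound : ∀ {b s t} → b ≤ s → s ≤ t → (s + t ∸ 1) ^ b * (c s * c t) ≤ oddDoubleFactorial b * c (s + t)
c-product-bound {t = t} z≤n z≤n = ≤-reflexive (*-identityˡ (c 0 * c t))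
c-product-bound {b} {suc s′} {suc t′} b≤s (s≤s s′≤t′) rewrite +-suc s′ t′ =
  *-cancelˡ-≤ (q ^ s) {{m^n≢0 q s}} (begin
  q ^ s * (q ^ b * (c s * c t))                   ≡⟨ regroup (q ^ s) (q ^ b) (c s) (c t) ⟩
  q ^ b * c s * (q ^ s * c t)                     ≤⟨ *-mono-≤ (*-monoʳ-≤ (q ^ b) c-small) c-large ⟩
  q ^ b * (q ^ (s ∸ b) * df b) * c n              ≡⟨ cong (_* c n) (*-assoc (q ^ b) (q ^ (s ∸ b)) (df b)) ⟨
  q ^ b * q ^ (s ∸ b) * df b * c n                ≡⟨ cong (λ k → k * df b * c n) (^-distribˡ-+-* q b (s ∸ b)) ⟨
  q ^ (b + (s ∸ b)) * df b * c n                  ≡⟨ cong (λ k → q ^ k * df b * c n) (m+[n∸m]≡n b≤s) ⟩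
  q ^ s * df b * c n                              ≡⟨ *-assoc (q ^ s) (df b) (c n) ⟩
  q ^ s * (df b * c n)                            ∎)
  where
  open ≤-Reasoning
  df = oddDoubleFactorial
  s = suc s′
  t = suc t′
  q = suc (s′ + t′)
  n = suc q
  regroup : ∀ x y u v → x * (y * (u * v)) ≡ y * u * (x * v)
  regroup = solve-∀
  s+s≤n : s + s ≤ n
  s+s≤n = s≤s (≤-trans (≤-reflexive (+-suc s′ s′)) (s≤s (+-monoʳ-≤ s′ s′≤t′)))
  c-small : c s ≤ q ^ (s ∸ b) * df b
  c-small = begin
    c s                   ≤⟨ c≤oddDoubleFactorial s ⟩
    df s                  ≡⟨ cong df (m∸n+n≡m b≤s) ⟨
    df (s ∸ b + b)        ≤⟨ oddDoubleFactorial-≤-^ (s ∸ b) b (subst (λ k → k + k ≤ n) (sym (m∸n+n≡m b≤s)) s+s≤n) ⟩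
    q ^ (s ∸ b) * df b    ∎
  c-large : q ^ s * c t ≤ c n
  c-large = c-grows-^ s t′ (s≤s (+-monoˡ-≤ t′ s′≤t′))

c-convolution-term-bound : ∀ {b k n} → b ≤ k → b ≤ n ∸ k → k ≤ n →
  (n ∸ 1) ^ b * (c k * c (n ∸ k)) ≤ oddDoubleFactorial b * c n
c-convolution-term-bound {b} {k} {n} b≤k b≤n∸k k≤n with ≤-total k (n ∸ k)
... | inj₁ k≤n∸k = subst (λ m → (m ∸ 1) ^ b * (c k * c (n ∸ k)) ≤ oddDoubleFactorial b * c m)
                     (m+[n∸m]≡n k≤n) (c-product-bound b≤k k≤n∸k)
... | inj₂ n∸k≤k = subst₂ (λ m x → (m ∸ 1) ^ b * x ≤ oddDoubleFactorial b * c m)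
                     (trans (+-comm (n ∸ k) k) (m+[n∸m]≡n k≤n)) (*-comm (c (n ∸ k)) (c k))
                     (c-product-bound b≤n∸k n∸k≤k)

-- The convolution sum

convSumConstant : ℕ → ℕ
convSumConstant i = 2 ^ i * (2 * oddDoubleFactorial (suc i) + oddDoubleFactorial (suc (suc i)))

-- Here j = i + 1 and n = 2j + 1 + e; term k is the convolution term of index j + k.
module ConvolutionBound (i e : ℕ) where

  private
    df = oddDoubleFactorial

  j n q : ℕ
  j = suc i
  n = j + (suc e + j)
  q = n ∸ 1

  0<q : 0 < q
  0<q = ≤-trans (s≤s z≤n) (m≤n+m (suc e + j) i)

  term : ℕ → ℕ
  term k = c (j + k) * c (n ∸ (j + k))

  convSum≡sum-term : convSum j n ≡ sum (applyUpTo term (suc (suc e)))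
  convSum≡sum-term = begin
    sum (map (λ k → c k * c (n ∸ k)) (map (j +_) (upTo (suc (n ∸ j) ∸ j))))
      ≡⟨ cong (λ l → sum (map (λ k → c k * c (n ∸ k)) (map (j +_) (upTo (suc l ∸ j))))) (m+n∸m≡n j (suc e + j)) ⟩
    sum (map (λ k → c k * c (n ∸ k)) (map (j +_) (upTo (suc (suc e + j) ∸ j))))
      ≡⟨ cong (λ l → sum (map (λ k → c k * c (n ∸ k)) (map (j +_) (upTo l)))) (m+n∸n≡m (suc (suc e)) j) ⟩
    sum (map (λ k → c k * c (n ∸ k)) (map (j +_) (upTo (suc (suc e)))))
      ≡⟨ cong sum (map-∘ {g = λ k → c k * c (n ∸ k)} {f = j +_} (upTo (suc (suc e)))) ⟨
    sum (map term (upTo (suc (suc e))))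
      ≡⟨ cong sum (map-upTo term (suc (suc e))) ⟩
    sum (applyUpTo term (suc (suc e)))    ∎
    where open ≡-Reasoning

  term-bound-at : ∀ {b} k → k ≤ suc e → b ≤ j + k → b ≤ (suc e ∸ k) + j → q ^ b * term k ≤ df b * c n
  term-bound-at {b} k k≤ b≤k b≤n∸k = c-convolution-term-bound b≤k (subst (b ≤_) (sym n∸[j+k]) b≤n∸k)
    (+-monoʳ-≤ j (≤-trans k≤ (m≤m+n (suc e) j)))
    where
    n∸[j+k] : n ∸ (j + k) ≡ (suc e ∸ k) + j
    n∸[j+k] = trans ([m+n]∸[m+o]≡n∸o j (suc e + j) k) (+-∸-comm j k≤)

  first-term : q ^ j * term 0 ≤ df j * c n
  first-term = term-bound-at 0 z≤n (≤-reflexive (sym (+-identityʳ j))) (m≤n+m j (suc e))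

  last-term : q ^ j * term (suc e) ≤ df j * c n
  last-term = term-bound-at (suc e) ≤-refl (m≤m+n j (suc e)) (≤-reflexive (sym (cong (_+ j) (n∸n≡0 (suc e)))))

  interior-term : ∀ k → k < e → q ^ suc j * term (suc k) ≤ df (suc j) * c n
  interior-term k k<e = term-bound-at (suc k) (s≤s (<⇒≤ k<e))
    (≤-trans (s≤s (m≤m+n j k)) (≤-reflexive (sym (+-suc j k))))
    (+-monoˡ-≤ j (m<n⇒0<n∸m k<e))

  interior-sum : q ^ j * sum (applyUpTo (term ∘ suc) e) ≤ df (suc j) * c n
  interior-sum = *-cancelˡ-≤ q {{>-nonZero 0<q}} (begin
    q * (q ^ j * sum (applyUpTo (term ∘ suc) e))     ≡⟨ *-assoc q (q ^ j) _ ⟨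
    q ^ suc j * sum (applyUpTo (term ∘ suc) e)       ≤⟨ *-sum-applyUpTo-≤ {a = q ^ suc j} (term ∘ suc) interior-term ⟩
    e * (df (suc j) * c n)                           ≤⟨ *-monoˡ-≤ (df (suc j) * c n) e≤q ⟩
    q * (df (suc j) * c n)                           ∎)
    where
    open ≤-Reasoning
    e≤q : e ≤ q
    e≤q = ≤-trans (m≤m+n e j) (≤-trans (n≤1+n (e + j)) (m≤n+m (suc e + j) i))

  weighted-convSum-bound : q ^ j * convSum j n ≤ (2 * df j + df (suc j)) * c n
  weighted-convSum-bound = begin
    q ^ j * convSum j n
      ≡⟨ cong (q ^ j *_) (trans convSum≡sum-term (sum-applyUpTo-ends term e)) ⟩
    q ^ j * (term 0 + (sum (applyUpTo (term ∘ suc) e) + term (suc e)))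
      ≡⟨ distribute (q ^ j) (term 0) _ (term (suc e)) ⟩
    q ^ j * term 0 + (q ^ j * sum (applyUpTo (term ∘ suc) e) + q ^ j * term (suc e))
      ≤⟨ +-mono-≤ first-term (+-mono-≤ interior-sum last-term) ⟩
    df j * c n + (df (suc j) * c n + df j * c n)
      ≡⟨ collect (df j) (df (suc j)) (c n) ⟩
    (2 * df j + df (suc j)) * c n  ∎
    where
    open ≤-Reasoning
    distribute : ∀ x a b d → x * (a + (b + d)) ≡ x * a + (x * b + x * d)
    distribute = solve-∀
    collect : ∀ a b x → a * x + (b * x + a * x) ≡ (2 * a + b) * x
    collect = solve-∀

  convSum-bound : q * convSum j n * n ^ i ≤ convSumConstant i * c n
  convSum-bound = begin
    q * convSum j n * n ^ i                    ≤⟨ *-monoʳ-≤ (q * convSum j n) (m≤n*o⇒m^k≤n^k*o^k i n≤2q) ⟩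
    q * convSum j n * (2 ^ i * q ^ i)          ≡⟨ regroup q (convSum j n) (2 ^ i) (q ^ i) ⟩
    2 ^ i * (q ^ j * convSum j n)              ≤⟨ *-monoʳ-≤ (2 ^ i) weighted-convSum-bound ⟩
    2 ^ i * ((2 * df j + df (suc j)) * c n)    ≡⟨ *-assoc (2 ^ i) (2 * df j + df (suc j)) (c n) ⟨
    2 ^ i * (2 * df j + df (suc j)) * c n      ∎
    where
    open ≤-Reasoning
    regroup : ∀ x s t u → x * s * (t * u) ≡ t * (x * u * s)
    regroup = solve-∀
    n≤2q : n ≤ 2 * q
    n≤2q = begin
      suc q      ≡⟨ +-comm 1 q ⟩
      q + 1      ≤⟨ +-monoʳ-≤ q 0<q ⟩
      q + q      ≡⟨ cong (q +_) (+-identityʳ q) ⟨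
      2 * q      ∎

-- The bound already holds for j = 1; the hypothesis 2 ≤ j only excludes j = 0.
lemma2p5 : ∀ (j : ℕ) → 2 ≤ j →
    ∃[ C ] ∃[ N ] (∀ (n : ℕ) → N ≤ n →
      (n ∸ 1) * convSum j n * n ^ (j ∸ 1) ≤ C * c n)
lemma2p5 zero ()
lemma2p5 (suc i) _ = convSumConstant i , N , bound
  where
  N = suc (suc i + suc i)
  bound : ∀ n → N ≤ n → (n ∸ 1) * convSum (suc i) n * n ^ i ≤ convSumConstant i * c n
  bound n N≤n = subst (λ m → (m ∸ 1) * convSum (suc i) m * m ^ i ≤ convSumConstant i * c m)
    (trans (rearrange i (n ∸ N)) (m+[n∸m]≡n N≤n)) (ConvolutionBound.convSum-bound i (n ∸ N))
    where
    rearrange : ∀ i e → suc i + (suc e + suc i) ≡ suc (suc i + suc i) + e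
    rearrange = solve-∀
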